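{- Let $G_\sigma$ be a signed graph. (a) The positively connected components of $G_\sigma$ are exactly: - the unbalanced connected components of $G_\sigma$; - for each balanced connected component in which not all edges are positive, the two subgraphs induced by the two sets of its Harary bipartition; - the connected components in which all edges are positive. (b) The negatively connected components of $G_\sigma$ are exactly: - the unbalanced connected components of $G_\sigma$; - the balanced connected components that are not all positive; - the individual vertices of the connected components in which all edges are positive.
   Context: A signed graph $G_\sigma=(V,E;\sigma)$ consists of a finite undirected graph, in which loops and multiple edges are allowed, with $\sigma:E\to\{\pm1\}$. Cycles are elementary; a loop is a cycle of length 1. Chains are walks. The sign of a cycle or chain is the product of its edge signs, counted with multiplicity. Balanced means every cycle is positive. A connected balanced signed graph with vertex set $U$ has a unique Harary bipartition $\{W,U\setminus W\}$: the partition such that an edge is negative exactly when it joins $W$ to $U\setminus W$. Equivalently, switching (negating all edges between $W$ and its complement) makes all edges positive. $G_\sigma$ is positively connected if every pair of distinct vertices is joined by a positive chain. The positively connected components are the maximal positively connected subgraphs. Two vertices are negatively connected if they are joined by a negative chain. A negatively connected component is a maximal subgraph in which every pair of vertices $u,v$ is negatively connected, or has a third vertex $w$ such that $u$ and $v$ are both negatively connected to $w$. -}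

module Defs where

open import Data.Nat using (ℕ; suc)
open import Data.Fin using (Fin)
open import Data.Fin.Subset using (Subset; _∈_; _∉_; _⊆_; Nonempty)
open import Data.Product using (Σ; _×_; _,_; proj₁; proj₂)
open import Data.Sum using (_⊎_)
open import Data.Sign using (Sign; +; -; _*_)
open import Data.List using (List; []; _∷_; length)
open import Data.List.Relation.Unary.Unique.Propositional using (Unique)
open import Relation.Binary.PropositionalEquality using (_≡_; _≢_)
open import Relation.Nullary using (¬_)
open import Function.Bundles using (_⇔_)

-- A signed graph on the vertex set Fin n: m edges, edge e has (unordered)
-- endpoints ends e (loops and multiple edges allowed) and sign σ e.
record SignedGraph (n : ℕ) : Set where
  field
    m    : ℕ
    ends : Fin m → Fin n × Fin n
    σ    : Fin m → Sign

module _ {n : ℕ} (G : SignedGraph n) where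
  open SignedGraph G

  Traverses : Fin m → Fin n → Fin n → Set
  Traverses e u w = (ends e ≡ (u , w)) ⊎ (ends e ≡ (w , u))

  data Walk : Fin n → Fin n → Set where
    []   : ∀ {v} → Walk v v
    step : ∀ {u w v} (e : Fin m) → Traverses e u w → Walk w v → Walk u v

  walkSign : ∀ {u v} → Walk u v → Sign
  walkSign []             = +
  walkSign (step e _ ws)  = σ e * walkSign ws

  walkEdges : ∀ {u v} → Walk u v → List (Fin m)
  walkEdges []            = []
  walkEdges (step e _ ws) = e ∷ walkEdges ws

  -- the vertex at which each step starts (for a closed walk v0 e1 v1 ... ek v0
  -- this is v0, v1, ..., v(k-1))
  walkStarts : ∀ {u v} → Walk u v → List (Fin n)
  walkStarts []                   = []
  walkStarts (step {u} e _ ws)    = u ∷ walkStarts ws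

  -- (elementary) cycle through v: closed chain of length ≥ 1 with pairwise
  -- distinct vertices and pairwise distinct edges; a loop is a cycle of length 1
  IsCycle : ∀ {v} → Walk v v → Set
  IsCycle c = (1 Data.Nat.≤ length (walkEdges c))
            × Unique (walkStarts c) × Unique (walkEdges c)

  Connected : Fin n → Fin n → Set
  Connected u v = Walk u v

  PosConnected : Fin n → Fin n → Set
  PosConnected u v = Σ (Walk u v) λ w → walkSign w ≡ +

  NegConnected : Fin n → Fin n → Set
  NegConnected u v = Σ (Walk u v) λ w → walkSign w ≡ -

  ConnectedSet : Subset n → Set
  ConnectedSet S = ∀ u v → u ∈ S → v ∈ S → Connected u v

  IsComponent : Subset n → Set
  IsComponent S = Nonempty S × ConnectedSet S
                × (∀ T → S ⊆ T → ConnectedSet T → T ⊆ S)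

  Balanced : Subset n → Set
  Balanced C = ∀ v → v ∈ C → (c : Walk v v) → IsCycle c → walkSign c ≡ +

  AllPositive : Subset n → Set
  AllPositive C = ∀ e → proj₁ (ends e) ∈ C → proj₂ (ends e) ∈ C → σ e ≡ +

  -- W ⊆ C is a Harary set for C: {W, C ─ W} is a Harary bipartition, i.e. an
  -- edge of C is negative exactly when it joins W to C ─ W
  IsHararySet : Subset n → Subset n → Set
  IsHararySet C W = W ⊆ C ×
    (∀ e → proj₁ (ends e) ∈ C → proj₂ (ends e) ∈ C →
       σ e ≡ - ⇔ ((proj₁ (ends e) ∈ W × proj₂ (ends e) ∉ W)
                 ⊎ (proj₁ (ends e) ∉ W × proj₂ (ends e) ∈ W)))

  PosConnectedSet : Subset n → Set
  PosConnectedSet S = ∀ u v → u ∈ S → v ∈ S → u ≢ v → PosConnected u v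

  IsPosComponent : Subset n → Set
  IsPosComponent S = Nonempty S × PosConnectedSet S
                   × (∀ T → S ⊆ T → PosConnectedSet T → T ⊆ S)

  NegConnectedSet : Subset n → Set
  NegConnectedSet S = ∀ u v → u ∈ S → v ∈ S → u ≢ v →
    NegConnected u v
    ⊎ Σ (Fin n) (λ w → w ∈ S × w ≢ u × w ≢ v × NegConnected u w × NegConnected v w)

  IsNegComponent : Subset n → Set
  IsNegComponent S = Nonempty S × NegConnectedSet S
                   × (∀ T → S ⊆ T → NegConnectedSet T → T ⊆ S)

module Submission where

-- Every connected component C is of exactly one of three kinds:
--   unbalanced  – some closed walk in C is negative;
--   mixed       – C carries a potential s (each edge of C has sign s(x)·s(y)),
--                 and some edge of C is negative;
--   all-positive.
-- This trichotomy rests on Harary's dichotomy: giving each vertex the sign of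
-- some walk from a fixed root, either every edge respects these signs (a
-- potential, hence C is balanced) or some edge closes a negative walk, and a
-- negative closed walk contains a negative cycle (repeatedly cut a walk at a
-- repeated vertex or edge; see 'reduce').  Potentials and Harary bipartitions
-- are the same thing: a Harary set is a level set of a potential.
--
-- For each kind we exhibit a set that is positively (negatively) connected and
-- absorbs every positively (negatively) connected set meeting it: the whole
-- component, the two level sets of the potential, or a single vertex.  A
-- general lemma on maximal sets ('maximal-absorbed', 'absorbing-maximal') then
-- identifies these with the positive (negative) components; the component of
-- a vertex exists as a subset because connectivity is decidable (walks can be
-- shortened to at most n steps).

open import Defs
open import Data.Bool using (if_then_else_)
open import Data.Empty using (⊥-elim)
open import Data.Fin using (Fin; zero; suc) renaming (_≟_ to _≟ᶠ_; _<_ to _<ᶠ_)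
open import Data.Fin.Properties using (any?; pigeonhole)
open import Data.Fin.Subset using (Subset; _∈_; _∉_; _⊆_; Nonempty; _─_; ⁅_⁆; inside; outside)
open import Data.Fin.Subset.Properties using (_∈?_; ⊆-antisym; x∈⁅x⁆; x∈⁅y⁆⇒x≡y)
open import Data.List using (List; []; _∷_; length; lookup)
open import Data.List.Membership.Propositional using () renaming (_∈_ to _∈ₗ_)
open import Data.List.Membership.Propositional.Properties using (∈-lookup)
open import Data.List.Relation.Unary.All as All using ()
open import Data.List.Relation.Unary.All.Properties.Core using (¬Any⇒All¬)
open import Data.List.Relation.Unary.AllPairs using ([]; _∷_)
open import Data.List.Relation.Unary.Any as Any using (here; there)
open import Data.List.Relation.Unary.Unique.Propositional using (Unique)
open import Data.Nat using (ℕ; zero; suc; _<_; _≤_; _≤?_; z≤n; s≤s)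
open import Data.Nat.Induction using (<-wellFounded)
open import Data.Nat.Properties using (≰⇒>; m<n⇒m<1+n; n<1+n)
open import Data.Product using (Σ; ∃; _×_; _,_; proj₁; proj₂)
open import Data.Product.Properties using (≡-dec)
open import Data.Sign using (Sign; +; -; _*_; opposite) renaming (_≟_ to _≟ˢ_)
open import Data.Sign.Properties
  using (s*s≡+; *-identityʳ; *-comm; *-assoc; *-cancelʳ-≡; s≢opposite[s]; *-commutativeSemigroup)
open import Algebra.Properties.CommutativeSemigroup *-commutativeSemigroup using (x∙yz≈y∙xz)
open import Data.Sum using (_⊎_; inj₁; inj₂)
open import Data.Vec.Base using (tabulate; _∷_; here; there)
open import Data.Vec.Properties using (lookup∘tabulate; []=⇒lookup; lookup⇒[]=)
open import Data.Bool.Properties using (T-≡)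
open import Function using (_∘_)
open import Function.Bundles using (_⇔_; mk⇔; Equivalence)
open import Function.Construct.Symmetry using (⇔-sym)
open import Function.Properties.Equivalence using (⇔-setoid)
open import Level using (0ℓ)
import Relation.Binary.Reasoning.Setoid as SetoidReasoning
open import Induction.WellFounded using (Acc; acc)
open import Relation.Binary.PropositionalEquality
open import Relation.Nullary using (¬_; ¬?; Dec; yes; no; does)
open import Relation.Nullary.Decidable
  using (map′; _×-dec_; _⊎-dec_; decidable-stable; toWitness; dec-true; isYes≗does)

module ⇔-Reasoning = SetoidReasoning (⇔-setoid 0ℓ)

subsetOf : ∀ {n} {P : Fin n → Set} → (∀ x → Dec (P x)) → Subset n
subsetOf P? = tabulate (λ x → does (P? x))

∈subsetOf : ∀ {n} {P : Fin n → Set} {P? : ∀ x → Dec (P x)} {x} → x ∈ subsetOf P? ⇔ P x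
∈subsetOf {P? = P?} {x} = mk⇔
  (λ x∈ → toWitness {a? = P? x} (Equivalence.from T-≡ (trans (isYes≗does (P? x))
            (trans (sym (lookup∘tabulate _ x)) ([]=⇒lookup x∈)))))
  (λ px → lookup⇒[]= x _ (trans (lookup∘tabulate _ x) (dec-true (P? x) px)))

unique-length≤ : ∀ {n} {xs : List (Fin n)} → Unique xs → length xs ≤ n
unique-length≤ {n} {xs} xs-unique with length xs ≤? n
... | yes ≤n = ≤n
... | no ≰n with pigeonhole (≰⇒> ≰n) (lookup xs)
...   | i , j , i<j , same = ⊥-elim (distinct xs xs-unique i j i<j same)
  where
  distinct : ∀ {A : Set} (ys : List A) → Unique ys → ∀ i j → i <ᶠ j → lookup ys i ≢ lookup ys j
  distinct (y ∷ ys) (y∉ys ∷ _)  zero    (suc j) _         = All.lookup y∉ys (∈-lookup j)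
  distinct (y ∷ ys) (_ ∷ uniq) (suc i) (suc j) (s≤s i<j) = distinct ys uniq i j i<j

∈─⁻ : ∀ {n} (p q : Subset n) {x} → x ∈ p ─ q → x ∈ p × x ∉ q
∈─⁻ (inside ∷ p)  (outside ∷ q) here       = here , λ ()
∈─⁻ (outside ∷ p) (outside ∷ q) {zero} ()
∈─⁻ (outside ∷ p) (inside ∷ q)  {zero} ()
∈─⁻ (inside ∷ p)  (inside ∷ q)  {zero} ()
∈─⁻ (_ ∷ p)      (_ ∷ q)       (there x∈) =
  let (x∈p , x∉q) = ∈─⁻ p q x∈ in there x∈p , λ { (there x∈q) → x∉q x∈q }

∈─⁺ : ∀ {n} (p q : Subset n) {x} → x ∈ p → x ∉ q → x ∈ p ─ q
∈─⁺ (inside ∷ p) (inside ∷ q)  here       x∉q = ⊥-elim (x∉q here)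
∈─⁺ (inside ∷ p) (outside ∷ q) here       x∉q = here
∈─⁺ (_ ∷ p)      (_ ∷ q)       (there x∈p) x∉q = there (∈─⁺ p q x∈p (x∉q ∘ there))

Xor : Set → Set → Set
Xor A B = (A × ¬ B) ⊎ (¬ A × B)

xor-cong : ∀ {A A′ B B′ : Set} → A ⇔ A′ → B ⇔ B′ → Xor A B ⇔ Xor A′ B′
xor-cong A⇔ B⇔ = mk⇔ (transport A⇔ B⇔) (transport (⇔-sym A⇔) (⇔-sym B⇔))
  where
  transport : ∀ {X X′ Y Y′ : Set} → X ⇔ X′ → Y ⇔ Y′ → Xor X Y → Xor X′ Y′
  transport X⇔ Y⇔ (inj₁ (x , ¬y)) = inj₁ (Equivalence.to X⇔ x , ¬y ∘ Equivalence.from Y⇔)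
  transport X⇔ Y⇔ (inj₂ (¬x , y)) = inj₂ (¬x ∘ Equivalence.from X⇔ , Equivalence.to Y⇔ y)

Maximal : ∀ {n} → (Subset n → Set) → Subset n → Set
Maximal P S = Nonempty S × P S × (∀ T → S ⊆ T → P T → T ⊆ S)

Absorbs : ∀ {n} → (Subset n → Set) → Subset n → Set
Absorbs P C = ∀ {T v} → P T → v ∈ T → v ∈ C → T ⊆ C

absorbing-maximal : ∀ {n P} {C : Subset n} → P C → Absorbs P C → Nonempty C → Maximal P C
absorbing-maximal P-C absorbs (v , v∈C) =
  (v , v∈C) , P-C , λ T C⊆T P-T → absorbs P-T (C⊆T v∈C) v∈C

maximal-absorbed : ∀ {n P} {C S : Subset n} {v} → P C → Absorbs P C →
                   Maximal P S → v ∈ S → v ∈ C → S ≡ C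
maximal-absorbed P-C absorbs (_ , P-S , S-max) v∈S v∈C =
  ⊆-antisym S⊆C (S-max _ S⊆C P-C)
  where S⊆C = absorbs P-S v∈S v∈C

two-valued : ∀ {a b : Sign} → a ≢ b → ∀ t → a ≡ t ⊎ b ≡ t
two-valued {+} {+} a≢b _ = ⊥-elim (a≢b refl)
two-valued { - } { - } a≢b _ = ⊥-elim (a≢b refl)
two-valued {+} { - } _ + = inj₁ refl
two-valued {+} { - } _ - = inj₂ refl
two-valued { - } {+} _ + = inj₂ refl
two-valued { - } {+} _ - = inj₁ refl

≢⇒*≡- : ∀ {a b : Sign} → a ≢ b → a * b ≡ -
≢⇒*≡- {+} {+} a≢b = ⊥-elim (a≢b refl)
≢⇒*≡- { - } { - } a≢b = ⊥-elim (a≢b refl)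
≢⇒*≡- {+} { - } _ = refl
≢⇒*≡- { - } {+} _ = refl

*≡-⇒≢ : ∀ {a b : Sign} → a * b ≡ - → a ≢ b
*≡-⇒≢ {a} a*b≡- refl with () ← trans (sym (s*s≡+ a)) a*b≡-

*≡+⇒≡ : ∀ {a b : Sign} → a * b ≡ + → a ≡ b
*≡+⇒≡ {a} {b} a*b≡+ = *-cancelʳ-≡ b a b (trans a*b≡+ (sym (s*s≡+ b)))

≢-⇒≡+ : ∀ {a : Sign} → a ≢ - → a ≡ +
≢-⇒≡+ {+} _ = refl
≢-⇒≡+ { - } a≢- = ⊥-elim (a≢- refl)

sign-by-neg : ∀ {a b : Sign} → (a ≡ - ⇔ b ≡ -) → a ≡ b
sign-by-neg {+} {+} _ = refl
sign-by-neg { - } { - } _ = refl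
sign-by-neg {+} { - } a⇔b with () ← Equivalence.from a⇔b refl
sign-by-neg { - } {+} a⇔b with () ← Equivalence.to a⇔b refl

≢⇔xor : ∀ {a b : Sign} t → a ≢ b ⇔ Xor (a ≡ t) (b ≡ t)
≢⇔xor {a} {b} t = mk⇔ to from
  where
  to : a ≢ b → Xor (a ≡ t) (b ≡ t)
  to a≢b with two-valued a≢b t
  ... | inj₁ a≡t = inj₁ (a≡t , λ b≡t → a≢b (trans a≡t (sym b≡t)))
  ... | inj₂ b≡t = inj₂ ((λ a≡t → a≢b (trans a≡t (sym b≡t))) , b≡t)
  from : Xor (a ≡ t) (b ≡ t) → a ≢ b
  from (inj₁ (a≡t , b≢t)) a≡b = b≢t (trans (sym a≡b) a≡t)
  from (inj₂ (a≢t , b≡t)) a≡b = a≢t (trans a≡b b≡t)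

*≡-⇔xor : ∀ {a b : Sign} t → a * b ≡ - ⇔ Xor (a ≡ t) (b ≡ t)
*≡-⇔xor {a} {b} t =
  mk⇔ (Equivalence.to (≢⇔xor {a} {b} t) ∘ *≡-⇒≢) (≢⇒*≡- ∘ Equivalence.from (≢⇔xor {a} {b} t))

cancel-middle : ∀ a b c → (a * b) * (b * c) ≡ a * c
cancel-middle a b c = begin
  (a * b) * (b * c) ≡⟨ *-assoc a b (b * c) ⟩
  a * (b * (b * c)) ≡⟨ cong (a *_) (sym (*-assoc b b c)) ⟩
  a * ((b * b) * c) ≡⟨ cong (λ z → a * (z * c)) (s*s≡+ b) ⟩
  a * c             ∎
  where open ≡-Reasoning

cancel-outer : ∀ a b c → a * (b * (a * c)) ≡ b * c
cancel-outer a b c = begin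
  a * (b * (a * c)) ≡⟨ x∙yz≈y∙xz a b (a * c) ⟩
  b * (a * (a * c)) ≡⟨ cong (b *_) (sym (*-assoc a a c)) ⟩
  b * ((a * a) * c) ≡⟨ cong (λ z → b * (z * c)) (s*s≡+ a) ⟩
  b * c             ∎
  where open ≡-Reasoning

flip-sign : ∀ {a t : Sign} → a ≢ t → - * a ≡ t
flip-sign {+} {+} a≢t = ⊥-elim (a≢t refl)
flip-sign { - } { - } a≢t = ⊥-elim (a≢t refl)
flip-sign {+} { - } _ = refl
flip-sign { - } {+} _ = refl

module _ {n : ℕ} (G : SignedGraph n) where
  open SignedGraph G

  private variable
    a b u v w x y : Fin n
    e f : Fin m
    C S T W : Subset n
    s : Fin n → Sign

  len : Walk G u v → ℕ
  len p = length (walkStarts G p)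

  infixr 5 _++ʷ_
  _++ʷ_ : Walk G u x → Walk G x v → Walk G u v
  []           ++ʷ q = q
  step e t p   ++ʷ q = step e t (p ++ʷ q)

  sign-++ : (p : Walk G u x) (q : Walk G x v) →
            walkSign G (p ++ʷ q) ≡ walkSign G p * walkSign G q
  sign-++ []           q = refl
  sign-++ (step e t p) q = trans (cong (σ e *_) (sign-++ p q)) (sym (*-assoc (σ e) _ _))

  traverse-back : Traverses G e u w → Traverses G e w u
  traverse-back (inj₁ ends≡) = inj₂ ends≡
  traverse-back (inj₂ ends≡) = inj₁ ends≡

  reverse : Walk G u v → Walk G v u
  reverse []           = []
  reverse (step e t p) = reverse p ++ʷ step e (traverse-back t) []

  sign-reverse : (p : Walk G u v) → walkSign G (reverse p) ≡ walkSign G p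
  sign-reverse []           = refl
  sign-reverse (step e t p) = begin
    walkSign G (reverse p ++ʷ step e (traverse-back t) [])
      ≡⟨ sign-++ (reverse p) _ ⟩
    walkSign G (reverse p) * (σ e * +)
      ≡⟨ cong₂ _*_ (sign-reverse p) (*-identityʳ (σ e)) ⟩
    walkSign G p * σ e
      ≡⟨ *-comm (walkSign G p) (σ e) ⟩
    σ e * walkSign G p
      ∎
    where open ≡-Reasoning

  detour-sign : (q : Walk G u y) (c : Walk G y y) (p : Walk G u x) →
                walkSign G (q ++ʷ c ++ʷ reverse q ++ʷ p) ≡ walkSign G c * walkSign G p
  detour-sign q c p = begin
    walkSign G (q ++ʷ c ++ʷ reverse q ++ʷ p)
      ≡⟨ sign-++ q _ ⟩
    walkSign G q * walkSign G (c ++ʷ reverse q ++ʷ p)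
      ≡⟨ cong (walkSign G q *_) (trans (sign-++ c _) (cong (walkSign G c *_) (sign-++ (reverse q) p))) ⟩
    walkSign G q * (walkSign G c * (walkSign G (reverse q) * walkSign G p))
      ≡⟨ cong (λ z → walkSign G q * (walkSign G c * (z * walkSign G p))) (sign-reverse q) ⟩
    walkSign G q * (walkSign G c * (walkSign G q * walkSign G p))
      ≡⟨ cancel-outer (walkSign G q) (walkSign G c) (walkSign G p) ⟩
    walkSign G c * walkSign G p
      ∎
    where open ≡-Reasoning

  data SplitAt {u v : Fin n} : Walk G u v → Fin m → Fin n → Fin n → Set where
    split : (P : Walk G u a) (t : Traverses G f a b) (Q : Walk G b v) →
            SplitAt (P ++ʷ step f t Q) f a b

  split-at-start : (p : Walk G u v) → x ∈ₗ walkStarts G p → ∃ λ f → ∃ λ b → SplitAt p f x b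
  split-at-start (step e t p) (here refl) = e , _ , split [] t p
  split-at-start (step e t p) (there x∈) with split-at-start p x∈
  ... | f , b , split P t′ Q = f , b , split (step e t P) t′ Q

  split-at-edge : (p : Walk G u v) → f ∈ₗ walkEdges G p → ∃ λ a → ∃ λ b → SplitAt p f a b
  split-at-edge (step e t p) (here refl) = _ , _ , split [] t p
  split-at-edge (step e t p) (there f∈) with split-at-edge p f∈
  ... | a , b , split P t′ Q = a , b , split (step e t P) t′ Q

  split-shorter : (P : Walk G u a) (t : Traverses G f a b) (Q : Walk G b v) →
                  len P < len (P ++ʷ step f t Q) × len Q < len (P ++ʷ step f t Q)
  split-shorter []            t Q = s≤s z≤n , n<1+n (len Q)
  split-shorter (step e t′ P) t Q =
    let (P< , Q<) = split-shorter P t Q in s≤s P< , m<n⇒m<1+n Q<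

  orientation : Traverses G e u w → Traverses G e a b → a ≡ u ⊎ (a ≡ w × b ≡ u)
  orientation (inj₁ e≡uw) (inj₁ e≡ab) = inj₁ (cong proj₁ (trans (sym e≡ab) e≡uw))
  orientation (inj₁ e≡uw) (inj₂ e≡ba) =
    inj₂ (cong proj₂ (trans (sym e≡ba) e≡uw) , cong proj₁ (trans (sym e≡ba) e≡uw))
  orientation (inj₂ e≡wu) (inj₁ e≡ab) =
    inj₂ (cong proj₁ (trans (sym e≡ab) e≡wu) , cong proj₂ (trans (sym e≡ab) e≡wu))
  orientation (inj₂ e≡wu) (inj₂ e≡ba) = inj₁ (cong proj₂ (trans (sym e≡ba) e≡wu))

  -- A reduction of a walk p : u → v: a closed walk (the loop, reachable from u)
  -- and a walk u → v (the rest), both shorter than p, whose signs multiply to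
  -- the sign of p.  A walk without reduction is elementary.
  record Reduction (p : Walk G u v) : Set where
    field
      hub          : Fin n
      toHub        : Walk G u hub
      loop         : Walk G hub hub
      rest         : Walk G u v
      sign-split   : walkSign G p ≡ walkSign G loop * walkSign G rest
      loop-shorter : len loop < len p
      rest-shorter : len rest < len p
  open Reduction

  reduction-cons : (t : Traverses G e u w) {p : Walk G w v} → Reduction p → Reduction (step e t p)
  reduction-cons {e} t r = record
    { hub = hub r ; toHub = step e t (toHub r) ; loop = loop r ; rest = step e t (rest r)
    ; sign-split   = trans (cong (σ e *_) (sign-split r))
                           (x∙yz≈y∙xz (σ e) (walkSign G (loop r)) (walkSign G (rest r)))
    ; loop-shorter = m<n⇒m<1+n (loop-shorter r)
    ; rest-shorter = s≤s (rest-shorter r) }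

  reduction-return : (t : Traverses G e u w) (P : Walk G w u) (t′ : Traverses G f u b)
                     (Q : Walk G b v) → Reduction (step e t (P ++ʷ step f t′ Q))
  reduction-return {e} {u} {f = f} t P t′ Q = record
    { hub = u ; toHub = [] ; loop = step e t P ; rest = step f t′ Q
    ; sign-split   = trans (cong (σ e *_) (sign-++ P _)) (sym (*-assoc (σ e) _ _))
    ; loop-shorter = s≤s (proj₁ (split-shorter P t′ Q))
    ; rest-shorter = s≤s (proj₂ (split-shorter P t′ Q)) }

  reduction-backtrack : (t : Traverses G e u w) (P : Walk G w w) (t′ : Traverses G e w u)
                        (Q : Walk G u v) → Reduction (step e t (P ++ʷ step e t′ Q))
  reduction-backtrack {e} {w = w} t P t′ Q = record
    { hub = w ; toHub = step e t [] ; loop = P ; rest = Q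
    ; sign-split   = trans (cong (σ e *_) (sign-++ P _)) (cancel-outer (σ e) (walkSign G P) (walkSign G Q))
    ; loop-shorter = m<n⇒m<1+n (proj₁ (split-shorter P t′ Q))
    ; rest-shorter = m<n⇒m<1+n (proj₂ (split-shorter P t′ Q)) }

  reduce : (p : Walk G u v) → Reduction p ⊎ (Unique (walkStarts G p) × Unique (walkEdges G p))
  reduce [] = inj₂ ([] , [])
  reduce (step {u} e t p) with reduce p
  ... | inj₁ r = inj₁ (reduction-cons t r)
  ... | inj₂ (starts-unique , edges-unique)
    with Any.any? (u ≟ᶠ_) (walkStarts G p) | Any.any? (e ≟ᶠ_) (walkEdges G p)
  ...   | yes u∈ | _ with split-at-start p u∈
  ...     | _ , _ , split P t′ Q = inj₁ (reduction-return t P t′ Q)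
  reduce (step e t p) | inj₂ _ | no _ | yes e∈ with split-at-edge p e∈
  ...     | _ , _ , split P t′ Q with orientation t t′
  ...       | inj₁ refl         = inj₁ (reduction-return t P t′ Q)
  ...       | inj₂ (refl , refl) = inj₁ (reduction-backtrack t P t′ Q)
  reduce (step e t p) | inj₂ (starts-unique , edges-unique) | no u∉ | no e∉ =
    inj₂ (¬Any⇒All¬ _ u∉ ∷ starts-unique , ¬Any⇒All¬ _ e∉ ∷ edges-unique)

  -- Every negative closed walk at x leads to a negative cycle: reduce it,
  -- and continue with whichever of loop and rest is negative.
  NegCycleFrom : Fin n → Set
  NegCycleFrom x = ∃ λ z → Walk G x z × Σ (Walk G z z) λ c → IsCycle G c × walkSign G c ≡ -

  negative-cycle : (c : Walk G x x) → walkSign G c ≡ - → NegCycleFrom x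
  negative-cycle c = go c (<-wellFounded (len c))
    where
    go : (c : Walk G y y) → Acc _<_ (len c) → walkSign G c ≡ - → NegCycleFrom y
    go c@(step _ _ _) (acc shorter) c-neg with reduce c
    ... | inj₂ (starts-unique , edges-unique) =
          _ , [] , c , (s≤s z≤n , starts-unique , edges-unique) , c-neg
    ... | inj₁ r with walkSign G (loop r) in loop-sign
    ...   | - = let (z , p , cycle) = go (loop r) (shorter (loop-shorter r)) loop-sign
                in z , toHub r ++ʷ p , cycle
    ...   | + = go (rest r) (shorter (rest-shorter r))
                  (trans (cong (_* walkSign G (rest r)) (sym loop-sign))
                         (trans (sym (sign-split r)) c-neg))

  shorten : Walk G u v → Σ (Walk G u v) λ p → len p ≤ n
  shorten p = go p (<-wellFounded (len p))
    where
    go : (p : Walk G u v) → Acc _<_ (len p) → Σ (Walk G u v) λ p → len p ≤ n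
    go p (acc shorter) with reduce p
    ... | inj₁ r                = go (rest r) (shorter (rest-shorter r))
    ... | inj₂ (starts-unique , _) = p , unique-length≤ starts-unique

  -- Connectivity is decidable: search all walks of at most k steps, k = n.
  ShortWalk : ℕ → Fin n → Fin n → Set
  ShortWalk k u v = Σ (Walk G u v) λ p → len p ≤ k

  traverses? : ∀ e u w → Dec (Traverses G e u w)
  traverses? e u w = (ends e ≟ₚ (u , w)) ⊎-dec (ends e ≟ₚ (w , u))
    where _≟ₚ_ = ≡-dec _≟ᶠ_ _≟ᶠ_

  shortWalk? : ∀ k u v → Dec (ShortWalk k u v)
  shortWalk? zero u v =
    map′ (λ { refl → [] , z≤n }) (λ { ([] , _) → refl ; (step _ _ _ , ()) }) (u ≟ᶠ v)
  shortWalk? (suc k) u v =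
    map′ from-parts to-parts
      (u ≟ᶠ v ⊎-dec any? λ e → any? λ w → traverses? e u w ×-dec shortWalk? k w v)
    where
    Parts = u ≡ v ⊎ ∃ λ e → ∃ λ w → Traverses G e u w × ShortWalk k w v
    from-parts : Parts → ShortWalk (suc k) u v
    from-parts (inj₁ refl)                 = [] , z≤n
    from-parts (inj₂ (e , _ , t , p , p≤k)) = step e t p , s≤s p≤k
    to-parts : ShortWalk (suc k) u v → Parts
    to-parts ([] , _)                 = inj₁ refl
    to-parts (step e t p , s≤s p≤k) = inj₂ (e , _ , t , p , p≤k)

  connected? : ∀ u v → Dec (Walk G u v)
  connected? u v = map′ proj₁ shorten (shortWalk? n u v)

  component : Fin n → Subset n
  component v = subsetOf (connected? v)

  ∈component : x ∈ component v ⇔ Walk G v x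
  ∈component {v = v} = ∈subsetOf {P? = connected? v}

  ∈own-component : ∀ v → v ∈ component v
  ∈own-component v = Equivalence.from ∈component []

  component-connected : ConnectedSet G (component v)
  component-connected a b a∈ b∈ =
    reverse (Equivalence.to ∈component a∈) ++ʷ Equivalence.to ∈component b∈

  component-isComponent : ∀ v → IsComponent G (component v)
  component-isComponent v =
    (v , ∈own-component v) , component-connected ,
    λ T C⊆T T-conn x∈T → Equivalence.from ∈component (T-conn v _ (C⊆T (∈own-component v)) x∈T)

  walk-stays : IsComponent G C → a ∈ C → Walk G a b → b ∈ C
  walk-stays {a = a} (_ , C-conn , C-max) a∈C p =
    C-max (component a) (λ x∈C → Equivalence.from ∈component (C-conn _ _ a∈C x∈C))
          component-connected (Equivalence.from ∈component p)

  component-absorbs : {P : Subset n → Set} → IsComponent G C →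
                      (∀ {T} → P T → ConnectedSet G T) → Absorbs P C
  component-absorbs C-comp connected P-T v∈T v∈C x∈T =
    walk-stays C-comp v∈C (connected P-T _ _ v∈T x∈T)

  pos⇒connected : PosConnectedSet G T → ConnectedSet G T
  pos⇒connected T-pos u x u∈T x∈T with u ≟ᶠ x
  ... | yes refl = []
  ... | no u≢x   = proj₁ (T-pos u x u∈T x∈T u≢x)

  neg⇒connected : NegConnectedSet G T → ConnectedSet G T
  neg⇒connected T-neg u x u∈T x∈T with u ≟ᶠ x
  ... | yes refl = []
  ... | no u≢x with T-neg u x u∈T x∈T u≢x
  ...   | inj₁ (p , _)                        = p
  ...   | inj₂ (_ , _ , _ , _ , (p , _) , (q , _)) = p ++ʷ reverse q

  record Potential (C : Subset n) (s : Fin n → Sign) : Set where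
    constructor potential
    field
      edge-sign : ∀ e → proj₁ (ends e) ∈ C → proj₂ (ends e) ∈ C →
                  σ e ≡ s (proj₁ (ends e)) * s (proj₂ (ends e))
  open Potential

  traversal-sign : Potential C s → Traverses G e a b → a ∈ C → b ∈ C → σ e ≡ s a * s b
  traversal-sign {C} {s} {e} pot (inj₁ e≡ab) a∈C b∈C =
    subst (λ (x , y) → x ∈ C → y ∈ C → σ e ≡ s x * s y) e≡ab (edge-sign pot e) a∈C b∈C
  traversal-sign {C} {s} {e} {a} {b} pot (inj₂ e≡ba) a∈C b∈C =
    trans (subst (λ (x , y) → x ∈ C → y ∈ C → σ e ≡ s x * s y) e≡ba (edge-sign pot e) b∈C a∈C)
          (*-comm (s b) (s a))

  potential-walk : IsComponent G C → Potential C s → a ∈ C →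
                   (p : Walk G a b) → walkSign G p ≡ s a * s b
  potential-walk {s = s} C-comp pot a∈C [] = sym (s*s≡+ (s _))
  potential-walk {s = s} {a} {b} C-comp pot a∈C (step {w = w} e t p) = begin
    σ e * walkSign G p
      ≡⟨ cong₂ _*_ (traversal-sign pot t a∈C w∈C) (potential-walk C-comp pot w∈C p) ⟩
    (s a * s w) * (s w * s b)
      ≡⟨ cancel-middle (s a) (s w) (s b) ⟩
    s a * s b
      ∎
    where
    open ≡-Reasoning
    w∈C = walk-stays C-comp a∈C (step e t [])

  potential⇒balanced : IsComponent G C → Potential C s → Balanced G C
  potential⇒balanced {s = s} C-comp pot v v∈C c _ =
    trans (potential-walk C-comp pot v∈C c) (s*s≡+ (s v))

  NegClosedWalk : Subset n → Set
  NegClosedWalk C = ∃ λ x → x ∈ C × Σ (Walk G x x) λ c → walkSign G c ≡ -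

  negClosed⇒unbalanced : IsComponent G C → NegClosedWalk C → ¬ Balanced G C
  negClosed⇒unbalanced C-comp (x , x∈C , c , c-neg) balanced
    with z , p , cycle , is-cycle , cycle-neg ← negative-cycle c c-neg
    with () ← trans (sym (balanced z (walk-stays C-comp x∈C p) cycle is-cycle)) cycle-neg

  -- the sign of a chosen walk from r to x (+ if there is none)
  rootSign : Fin n → Fin n → Sign
  rootSign r x with connected? r x
  ... | yes p = walkSign G p
  ... | no _  = +

  rootSign-walk : Walk G a x → Σ (Walk G a x) λ p → rootSign a x ≡ walkSign G p
  rootSign-walk {a} {x} p with connected? a x
  ... | yes q = q , refl
  ... | no ¬p = ⊥-elim (¬p p)

  violation⇒negClosed : ConnectedSet G C → a ∈ C → ∀ e →
    proj₁ (ends e) ∈ C → proj₂ (ends e) ∈ C →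
    σ e ≢ rootSign a (proj₁ (ends e)) * rootSign a (proj₂ (ends e)) → NegClosedWalk C
  violation⇒negClosed {a = r} C-conn r∈C e x∈C y∈C σ≢
    with p , p-sign ← rootSign-walk (C-conn _ _ r∈C x∈C)
       | q , q-sign ← rootSign-walk (C-conn _ _ r∈C y∈C) =
    r , r∈C , p ++ʷ step e (inj₁ refl) (reverse q) , (begin
      walkSign G (p ++ʷ step e (inj₁ refl) (reverse q))
        ≡⟨ sign-++ p _ ⟩
      walkSign G p * (σ e * walkSign G (reverse q))
        ≡⟨ cong (λ z → walkSign G p * (σ e * z)) (sign-reverse q) ⟩
      walkSign G p * (σ e * walkSign G q)
        ≡⟨ x∙yz≈y∙xz (walkSign G p) (σ e) (walkSign G q) ⟩
      σ e * (walkSign G p * walkSign G q)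
        ≡⟨ ≢⇒*≡- (λ σ≡ → σ≢ (trans σ≡ (cong₂ _*_ (sym p-sign) (sym q-sign)))) ⟩
      - ∎)
    where open ≡-Reasoning

  negClosed-or-potential : IsComponent G C → NegClosedWalk C ⊎ Σ (Fin n → Sign) (Potential C)
  negClosed-or-potential {C} ((r , r∈C) , C-conn , _)
    with any? (λ e → proj₁ (ends e) ∈? C ×-dec proj₂ (ends e) ∈? C
                     ×-dec ¬? (σ e ≟ˢ rootSign r (proj₁ (ends e)) * rootSign r (proj₂ (ends e))))
  ... | yes (e , x∈C , y∈C , σ≢) = inj₁ (violation⇒negClosed C-conn r∈C e x∈C y∈C σ≢)
  ... | no no-violation = inj₂ (rootSign r , potential λ e x∈C y∈C →
          decidable-stable (σ e ≟ˢ _) (λ σ≢ → no-violation (e , x∈C , y∈C , σ≢)))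

  NegEdge : Subset n → Set
  NegEdge C = Σ (Fin m) λ e → proj₁ (ends e) ∈ C × proj₂ (ends e) ∈ C × σ e ≡ -

  allPositive-or-negEdge : ∀ C → AllPositive G C ⊎ NegEdge C
  allPositive-or-negEdge C
    with any? (λ e → proj₁ (ends e) ∈? C ×-dec proj₂ (ends e) ∈? C ×-dec σ e ≟ˢ -)
  ... | yes neg-edge = inj₂ neg-edge
  ... | no no-neg    = inj₁ λ e x∈C y∈C → ≢-⇒≡+ (λ σ≡- → no-neg (e , x∈C , y∈C , σ≡-))

  negEdge⇒¬allPositive : NegEdge C → ¬ AllPositive G C
  negEdge⇒¬allPositive (e , x∈C , y∈C , σ≡-) all-pos
    with () ← trans (sym (all-pos e x∈C y∈C)) σ≡-

  data Kind (C : Subset n) : Set where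
    unbalanced  : NegClosedWalk C → Kind C
    mixed       : (s : Fin n → Sign) → Potential C s → NegEdge C → Kind C
    allPositive : AllPositive G C → Kind C

  kind : IsComponent G C → Kind C
  kind {C} C-comp with negClosed-or-potential C-comp | allPositive-or-negEdge C
  ... | inj₁ neg-closed | _              = unbalanced neg-closed
  ... | inj₂ (s , pot)  | inj₂ neg-edge  = mixed s pot neg-edge
  ... | inj₂ _          | inj₁ all-pos   = allPositive all-pos

  ¬balanced⇒negClosed : IsComponent G C → ¬ Balanced G C → NegClosedWalk C
  ¬balanced⇒negClosed C-comp not-balanced with negClosed-or-potential C-comp
  ... | inj₁ neg-closed = neg-closed
  ... | inj₂ (_ , pot)  = ⊥-elim (not-balanced (potential⇒balanced C-comp pot))

  balanced⇒potential : IsComponent G C → Balanced G C → Σ (Fin n → Sign) (Potential C)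
  balanced⇒potential C-comp balanced with negClosed-or-potential C-comp
  ... | inj₁ neg-closed = ⊥-elim (negClosed⇒unbalanced C-comp neg-closed balanced)
  ... | inj₂ s-pot      = s-pot

  ¬allPositive⇒negEdge : ¬ AllPositive G C → NegEdge C
  ¬allPositive⇒negEdge {C} not-all-pos with allPositive-or-negEdge C
  ... | inj₁ all-pos  = ⊥-elim (not-all-pos all-pos)
  ... | inj₂ neg-edge = neg-edge

  -- In a component with a negative closed walk, any two vertices are joined by
  -- walks of both signs: a detour around the negative closed walk flips the sign.
  both-signs : IsComponent G C → NegClosedWalk C → u ∈ C → x ∈ C →
               ∀ t → Σ (Walk G u x) λ p → walkSign G p ≡ t
  both-signs (_ , C-conn , _) (y , y∈C , c , c-neg) u∈C x∈C t
    with walkSign G (C-conn _ _ u∈C x∈C) ≟ˢ t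
  ... | yes p-sign = C-conn _ _ u∈C x∈C , p-sign
  ... | no p≢t     =
    detour , trans (detour-sign q c p) (trans (cong (_* walkSign G p) c-neg) (flip-sign p≢t))
    where
    p = C-conn _ _ u∈C x∈C
    q = C-conn _ _ u∈C y∈C
    detour = q ++ʷ c ++ʷ reverse q ++ʷ p

  unbalanced-posConnected : IsComponent G C → NegClosedWalk C → PosConnectedSet G C
  unbalanced-posConnected C-comp neg-closed u x u∈C x∈C _ = both-signs C-comp neg-closed u∈C x∈C +

  unbalanced-negConnected : IsComponent G C → NegClosedWalk C → NegConnectedSet G C
  unbalanced-negConnected C-comp neg-closed u x u∈C x∈C _ =
    inj₁ (both-signs C-comp neg-closed u∈C x∈C -)

  allPositive-walk : IsComponent G C → AllPositive G C → u ∈ C →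
                     (p : Walk G u x) → walkSign G p ≡ +
  allPositive-walk C-comp all-pos = potential-walk C-comp (potential {s = λ _ → +} all-pos)

  allPositive-posConnected : IsComponent G C → AllPositive G C → PosConnectedSet G C
  allPositive-posConnected C-comp@(_ , C-conn , _) all-pos u x u∈C x∈C _ =
    C-conn u x u∈C x∈C , allPositive-walk C-comp all-pos u∈C (C-conn u x u∈C x∈C)

  negative-from : NegConnectedSet G T → v ∈ T → x ∈ T → v ≢ x → ∃ λ y → NegConnected G v y
  negative-from T-neg v∈T x∈T v≢x with T-neg _ _ v∈T x∈T v≢x
  ... | inj₁ neg-walk                         = _ , neg-walk
  ... | inj₂ (y , _ , _ , _ , neg-walk , _) = y , neg-walk

  allPositive-singleton-absorbs : IsComponent G C → AllPositive G C → v ∈ C →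
                                  Absorbs (NegConnectedSet G) ⁅ v ⁆
  allPositive-singleton-absorbs {v = v} C-comp all-pos v∈C {T} T-neg w∈T w∈⁅v⁆ {x} x∈T
    with x ≟ᶠ v
  ... | yes refl = x∈⁅x⁆ v
  ... | no x≢v
    with _ , p , p-neg ← negative-from T-neg (subst (_∈ T) (x∈⁅y⁆⇒x≡y v w∈⁅v⁆) w∈T) x∈T
                                       (x≢v ∘ sym)
    with () ← trans (sym (allPositive-walk C-comp all-pos v∈C p)) p-neg

  singleton-negConnected : NegConnectedSet G ⁅ v ⁆
  singleton-negConnected {v} u x u∈ x∈ u≢x =
    ⊥-elim (u≢x (trans (x∈⁅y⁆⇒x≡y v u∈) (sym (x∈⁅y⁆⇒x≡y v x∈))))

  potential-posConnected : IsComponent G C → Potential C s → a ∈ C → b ∈ C →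
                           s a ≡ s b → PosConnected G a b
  potential-posConnected {s = s} C-comp@(_ , C-conn , _) pot a∈C b∈C sa≡sb =
    p , trans (potential-walk C-comp pot a∈C p) (trans (cong (_* s _) sa≡sb) (s*s≡+ (s _)))
    where p = C-conn _ _ a∈C b∈C

  potential-negConnected : IsComponent G C → Potential C s → a ∈ C → b ∈ C →
                           s a ≢ s b → NegConnected G a b
  potential-negConnected C-comp@(_ , C-conn , _) pot a∈C b∈C sa≢sb =
    p , trans (potential-walk C-comp pot a∈C p) (≢⇒*≡- sa≢sb)
    where p = C-conn _ _ a∈C b∈C

  -- a negative edge has ends of different potential, so both potential values occur
  negEdge-level : Potential C s → NegEdge C → ∀ t → ∃ λ w → w ∈ C × s w ≡ t
  negEdge-level pot (e , x∈C , y∈C , σ≡-) t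
    with two-valued (*≡-⇒≢ (trans (sym (edge-sign pot e x∈C y∈C)) σ≡-)) t
  ... | inj₁ sx≡t = _ , x∈C , sx≡t
  ... | inj₂ sy≡t = _ , y∈C , sy≡t

  -- a balanced component with a negative edge is negatively connected: vertices of
  -- equal potential share a negatively connected neighbour of the other potential
  mixed-negConnected : IsComponent G C → Potential C s → NegEdge C → NegConnectedSet G C
  mixed-negConnected {s = s} C-comp pot neg-edge u x u∈C x∈C u≢x with s u ≟ˢ s x
  ... | no su≢sx  = inj₁ (potential-negConnected C-comp pot u∈C x∈C su≢sx)
  ... | yes su≡sx with w , w∈C , sw≡ ← negEdge-level pot neg-edge (opposite (s u)) =
    inj₂ (w , w∈C , sw≢su ∘ cong s , (λ w≡x → sw≢su (trans (cong s w≡x) (sym su≡sx))) ,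
          potential-negConnected C-comp pot u∈C w∈C (sw≢su ∘ sym) ,
          potential-negConnected C-comp pot x∈C w∈C
            (λ sx≡sw → sw≢su (trans (sym sx≡sw) (sym su≡sx))))
    where
    sw≢su : s w ≢ s u
    sw≢su sw≡su = s≢opposite[s] (s u) (trans (sym sw≡su) sw≡)

  IsLevel : Subset n → (Fin n → Sign) → Sign → Subset n → Set
  IsLevel C s t S = ∀ x → x ∈ S ⇔ (x ∈ C × s x ≡ t)

  level : Subset n → (Fin n → Sign) → Sign → Subset n
  level C s t = subsetOf (λ x → x ∈? C ×-dec s x ≟ˢ t)

  level-isLevel : ∀ C s t → IsLevel C s t (level C s t)
  level-isLevel C s t x = ∈subsetOf {P? = λ x → x ∈? C ×-dec s x ≟ˢ t}

  level-posConnected : ∀ {t} → IsComponent G C → Potential C s → IsLevel C s t S →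
                       PosConnectedSet G S
  level-posConnected C-comp pot S-level a b a∈S b∈S _ =
    let (a∈C , sa≡t) = Equivalence.to (S-level a) a∈S
        (b∈C , sb≡t) = Equivalence.to (S-level b) b∈S
    in potential-posConnected C-comp pot a∈C b∈C (trans sa≡t (sym sb≡t))

  level-absorbs : ∀ {t} → IsComponent G C → Potential C s → IsLevel C s t S →
                  Absorbs (PosConnectedSet G) S
  level-absorbs {s = s} C-comp pot S-level {T} {v} T-pos v∈T v∈S {x} x∈T with v ≟ᶠ x
  ... | yes refl = v∈S
  ... | no v≢x =
    let (v∈C , sv≡t) = Equivalence.to (S-level v) v∈S
        (p , p-pos)  = T-pos v x v∈T x∈T v≢x
        sv≡sx        = *≡+⇒≡ (trans (sym (potential-walk C-comp pot v∈C p)) p-pos)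
    in Equivalence.from (S-level x) (walk-stays C-comp v∈C p , trans (sym sv≡sx) sv≡t)

  level-posComponent : ∀ {t} → IsComponent G C → Potential C s → NegEdge C → IsLevel C s t S →
                       IsPosComponent G S
  level-posComponent {t = t} C-comp pot neg-edge S-level =
    absorbing-maximal (level-posConnected C-comp pot S-level) (level-absorbs C-comp pot S-level)
      (let (w , w∈C , sw≡t) = negEdge-level pot neg-edge t
       in w , Equivalence.from (S-level w) (w∈C , sw≡t))

  level-harary : ∀ {t} → Potential C s → IsLevel C s t W → IsHararySet G C W
  level-harary {C} {s} {W} {t} pot W-level =
    (λ {x} x∈W → proj₁ (Equivalence.to (W-level x) x∈W)) , λ e x∈C y∈C →
      let open ⇔-Reasoning in begin
      σ e ≡ -
        ≈⟨ ≡-respects (edge-sign pot e x∈C y∈C) ⟩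
      s (proj₁ (ends e)) * s (proj₂ (ends e)) ≡ -
        ≈⟨ *≡-⇔xor t ⟩
      Xor (s (proj₁ (ends e)) ≡ t) (s (proj₂ (ends e)) ≡ t)
        ≈⟨ xor-cong (in-level x∈C) (in-level y∈C) ⟩
      Xor (proj₁ (ends e) ∈ W) (proj₂ (ends e) ∈ W)
        ∎
    where
    ≡-respects : ∀ {a b : Sign} → a ≡ b → (a ≡ -) ⇔ (b ≡ -)
    ≡-respects a≡b = mk⇔ (trans (sym a≡b)) (trans a≡b)
    in-level : x ∈ C → (s x ≡ t) ⇔ (x ∈ W)
    in-level {x} x∈C = mk⇔ (λ sx≡t → Equivalence.from (W-level x) (x∈C , sx≡t))
                           (λ x∈W → proj₂ (Equivalence.to (W-level x) x∈W))

  indicator : Subset n → Fin n → Sign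
  indicator W x = if does (x ∈? W) then - else +

  indicator≡- : indicator W x ≡ - ⇔ x ∈ W
  indicator≡- {W} {x} with x ∈? W
  ... | yes x∈W = mk⇔ (λ _ → x∈W) (λ _ → refl)
  ... | no x∉W  = mk⇔ (λ ()) (λ x∈W → ⊥-elim (x∉W x∈W))

  indicator≡+ : indicator W x ≡ + ⇔ x ∉ W
  indicator≡+ {W} {x} with x ∈? W
  ... | yes x∈W = mk⇔ (λ ()) (λ x∉W → ⊥-elim (x∉W x∈W))
  ... | no x∉W  = mk⇔ (λ _ → x∉W) (λ _ → refl)

  harary-potential : IsHararySet G C W → Potential C (indicator W)
  harary-potential {W = W} (_ , harary) = potential λ e x∈C y∈C → sign-by-neg (
    let open ⇔-Reasoning in begin
    σ e ≡ -
      ≈⟨ harary e x∈C y∈C ⟩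
    Xor (proj₁ (ends e) ∈ W) (proj₂ (ends e) ∈ W)
      ≈⟨ xor-cong (⇔-sym indicator≡-) (⇔-sym indicator≡-) ⟩
    Xor (indicator W (proj₁ (ends e)) ≡ -) (indicator W (proj₂ (ends e)) ≡ -)
      ≈⟨ ⇔-sym (*≡-⇔xor -) ⟩
    indicator W (proj₁ (ends e)) * indicator W (proj₂ (ends e)) ≡ -
      ∎)

  harary-levels : IsHararySet G C W → IsLevel C (indicator W) - W × IsLevel C (indicator W) + (C ─ W)
  harary-levels {C} {W} (W⊆C , _) =
    (λ x → mk⇔ (λ x∈W → W⊆C x∈W , Equivalence.from indicator≡- x∈W)
               (λ (_ , ind≡-) → Equivalence.to indicator≡- ind≡-)) ,
    (λ x → mk⇔ (λ x∈C─W → let (x∈C , x∉W) = ∈─⁻ C W x∈C─W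
                            in x∈C , Equivalence.from indicator≡+ x∉W)
               (λ (x∈C , ind≡+) → ∈─⁺ C W x∈C (Equivalence.to indicator≡+ ind≡+)))

  PosShape : Subset n → Set
  PosShape S = (IsComponent G S × ¬ Balanced G S)
    ⊎ (Σ (Subset n) (λ C → IsComponent G C × Balanced G C × ¬ AllPositive G C
         × Σ (Subset n) (λ W → IsHararySet G C W × (S ≡ W ⊎ S ≡ C ─ W))))
    ⊎ (IsComponent G S × AllPositive G S)

  NegShape : Subset n → Set
  NegShape S = (IsComponent G S × ¬ Balanced G S)
    ⊎ (IsComponent G S × Balanced G S × ¬ AllPositive G S)
    ⊎ Σ (Subset n) (λ C → IsComponent G C × AllPositive G C
         × Σ (Fin n) (λ v → v ∈ C × S ≡ ⁅ v ⁆))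

  pos-absorbs : IsComponent G C → Absorbs (PosConnectedSet G) C
  pos-absorbs C-comp = component-absorbs C-comp pos⇒connected

  neg-absorbs : IsComponent G C → Absorbs (NegConnectedSet G) C
  neg-absorbs C-comp = component-absorbs C-comp neg⇒connected

  posComponent-level : IsComponent G C → Potential C s → IsPosComponent G S → v ∈ S → v ∈ C →
                       S ≡ level C s (s v)
  posComponent-level {C} {s} {v = v} C-comp pot S-pos v∈S v∈C =
    maximal-absorbed (level-posConnected C-comp pot v-level) (level-absorbs C-comp pot v-level)
      S-pos v∈S (Equivalence.from (v-level v) (v∈C , refl))
    where v-level = level-isLevel C s (s v)

  pos-shape : IsPosComponent G S → v ∈ S → IsComponent G C → v ∈ C → Kind C → PosShape S
  pos-shape S-pos v∈S C-comp v∈C (unbalanced neg-closed)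
    with refl ← maximal-absorbed (unbalanced-posConnected C-comp neg-closed) (pos-absorbs C-comp)
                  S-pos v∈S v∈C
    = inj₁ (C-comp , negClosed⇒unbalanced C-comp neg-closed)
  pos-shape {v = v} {C} S-pos v∈S C-comp v∈C (mixed s pot neg-edge)
    with refl ← posComponent-level C-comp pot S-pos v∈S v∈C
    = inj₂ (inj₁ (C , C-comp , potential⇒balanced C-comp pot , negEdge⇒¬allPositive neg-edge ,
                  level C s (s v) , level-harary pot (level-isLevel C s (s v)) , inj₁ refl))
  pos-shape S-pos v∈S C-comp v∈C (allPositive all-pos)
    with refl ← maximal-absorbed (allPositive-posConnected C-comp all-pos) (pos-absorbs C-comp)
                  S-pos v∈S v∈C
    = inj₂ (inj₂ (C-comp , all-pos))

  neg-shape : IsNegComponent G S → v ∈ S → IsComponent G C → v ∈ C → Kind C → NegShape S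
  neg-shape S-neg v∈S C-comp v∈C (unbalanced neg-closed)
    with refl ← maximal-absorbed (unbalanced-negConnected C-comp neg-closed) (neg-absorbs C-comp)
                  S-neg v∈S v∈C
    = inj₁ (C-comp , negClosed⇒unbalanced C-comp neg-closed)
  neg-shape S-neg v∈S C-comp v∈C (mixed s pot neg-edge)
    with refl ← maximal-absorbed (mixed-negConnected C-comp pot neg-edge) (neg-absorbs C-comp)
                  S-neg v∈S v∈C
    = inj₂ (inj₁ (C-comp , potential⇒balanced C-comp pot , negEdge⇒¬allPositive neg-edge))
  neg-shape {v = v} {C} S-neg v∈S C-comp v∈C (allPositive all-pos) =
    inj₂ (inj₂ (C , C-comp , all-pos , v , v∈C ,
      maximal-absorbed singleton-negConnected (allPositive-singleton-absorbs C-comp all-pos v∈C)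
        S-neg v∈S (x∈⁅x⁆ v)))

  component-posComponent : IsComponent G C → PosConnectedSet G C → IsPosComponent G C
  component-posComponent C-comp C-pos = absorbing-maximal C-pos (pos-absorbs C-comp) (proj₁ C-comp)

  component-negComponent : IsComponent G C → NegConnectedSet G C → IsNegComponent G C
  component-negComponent C-comp C-neg = absorbing-maximal C-neg (neg-absorbs C-comp) (proj₁ C-comp)

  pos-forward : IsPosComponent G S → PosShape S
  pos-forward S-pos@((v , v∈S) , _) =
    pos-shape S-pos v∈S (component-isComponent v) (∈own-component v) (kind (component-isComponent v))

  pos-backward : PosShape S → IsPosComponent G S
  pos-backward (inj₁ (S-comp , not-balanced)) =
    component-posComponent S-comp
      (unbalanced-posConnected S-comp (¬balanced⇒negClosed S-comp not-balanced))
  pos-backward (inj₂ (inj₁ (C , C-comp , _ , not-all-pos , W , harary , inj₁ refl))) =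
    level-posComponent C-comp (harary-potential harary) (¬allPositive⇒negEdge not-all-pos)
      (proj₁ (harary-levels harary))
  pos-backward (inj₂ (inj₁ (C , C-comp , _ , not-all-pos , W , harary , inj₂ refl))) =
    level-posComponent C-comp (harary-potential harary) (¬allPositive⇒negEdge not-all-pos)
      (proj₂ (harary-levels harary))
  pos-backward (inj₂ (inj₂ (S-comp , all-pos))) =
    component-posComponent S-comp (allPositive-posConnected S-comp all-pos)

  neg-forward : IsNegComponent G S → NegShape S
  neg-forward S-neg@((v , v∈S) , _) =
    neg-shape S-neg v∈S (component-isComponent v) (∈own-component v) (kind (component-isComponent v))

  neg-backward : NegShape S → IsNegComponent G S
  neg-backward (inj₁ (S-comp , not-balanced)) =
    component-negComponent S-comp
      (unbalanced-negConnected S-comp (¬balanced⇒negClosed S-comp not-balanced))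
  neg-backward (inj₂ (inj₁ (S-comp , balanced , not-all-pos))) =
    let (s , pot) = balanced⇒potential S-comp balanced
    in component-negComponent S-comp (mixed-negConnected S-comp pot (¬allPositive⇒negEdge not-all-pos))
  neg-backward (inj₂ (inj₂ (C , C-comp , all-pos , v , v∈C , refl))) =
    absorbing-maximal singleton-negConnected (allPositive-singleton-absorbs C-comp all-pos v∈C) (v , x∈⁅x⁆ v)

proposition7p3 : ∀ {n} (G : SignedGraph n) →
    (∀ (S : Subset n) → IsPosComponent G S ⇔
        ((IsComponent G S × ¬ Balanced G S)
         ⊎ (Σ (Subset n) (λ C → IsComponent G C × Balanced G C × ¬ AllPositive G C
              × Σ (Subset n) (λ W → IsHararySet G C W × (S ≡ W ⊎ S ≡ C ─ W))))
         ⊎ (IsComponent G S × AllPositive G S)))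
    × (∀ (S : Subset n) → IsNegComponent G S ⇔
        ((IsComponent G S × ¬ Balanced G S)
         ⊎ (IsComponent G S × Balanced G S × ¬ AllPositive G S)
         ⊎ Σ (Subset n) (λ C → IsComponent G C × AllPositive G C
              × Σ (Fin n) (λ v → v ∈ C × S ≡ ⁅ v ⁆))))
proposition7p3 G =
  (λ S → mk⇔ (pos-forward G) (pos-backward G)) ,
  (λ S → mk⇔ (neg-forward G) (neg-backward G))
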